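{- Let $p\le7$ be a prime, and let $A_p$ be the set of natural numbers not divisible by any prime $p'\le p$. Then for every real $x\ge0$, $$\#(A_p\cap[1,x]) = x\prod_{p'\le p}\left(1-\frac1{p'}\right) + E$$ for some $E$ with $|E|\le 53/35$ (the product being over primes $p'\le p$).
   Formalization: The variable x ranges over the nonnegative rationals instead of all real x ≥ 0. -}

module Defs where

open import Data.Nat using (ℕ; zero; suc; _≤_)
open import Data.Nat.Divisibility using (_∣_)
open import Data.Nat.Primality using (Prime; prime?)
open import Data.Integer using (+_)
open import Data.Rational using (ℚ; _/_; _*_; _-_; 1ℚ) renaming (_≤_ to _≤ℚ_)
open import Data.List using (List; length)
open import Data.List.Membership.Propositional using (_∈_)
open import Data.List.Relation.Unary.Unique.Propositional using (Unique)
open import Data.Product using (_×_; Σ-syntax)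
open import Relation.Nullary using (¬_; yes; no)
open import Relation.Binary.PropositionalEquality using (_≡_)
open import Function.Bundles using (_⇔_)

A : ℕ → ℕ → Set
A p n = ∀ q → Prime q → q ≤ p → ¬ (q ∣ n)

ι : ℕ → ℚ
ι n = + n / 1

-- "#(A_p ∩ [1,x]) = k": k is the number of naturals n with n ∈ A_p and
-- 1 ≤ n ≤ x, witnessed by a duplicate-free list enumerating exactly that set.
CountIs : ℕ → ℚ → ℕ → Set
CountIs p x k =
  Σ[ l ∈ List ℕ ] (Unique l × (∀ n → (n ∈ l) ⇔ (A p n × 1 ≤ n × ι n ≤ℚ x)) × length l ≡ k)

eulerProd : ℕ → ℚ
eulerProd zero = 1ℚ
eulerProd (suc m) with prime? (suc m)
... | yes _ = (1ℚ - (+ 1 / suc m)) * eulerProd m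
... | no  _ = eulerProd m

{-# OPTIONS --safe #-}

-- Let N(n) = #(A_p ∩ [1, n]), c = ∏_{p' ≤ p} (1 - 1/p') and let M be the primorial of p.
-- Membership in A_p depends only on n mod M, so N(n + qM) = N(n) + q N(M), and N(M) = M c;
-- hence the discrepancy N(n) - n c is M-periodic. For x ∈ [n, n + 1] the error N(n) - x c lies
-- between N(n) - (n + 1) c and N(n) - n c, so it suffices to bound these two numbers for
-- n < M ≤ 210, which is done by evaluation (as is N(M) = M c).

module Submission where

open import Defs
open import Level using (0ℓ)
open import Data.Bool.Base using (true; false; if_then_else_)
open import Data.Bool.Properties using (if-float)
open import Data.Nat.Base as ℕ using (ℕ; zero; suc; _≤_; _<_; NonZero; z≤n; s≤s)
import Data.Nat.Properties as ℕ
open import Data.Nat.DivMod using (m≡m%n+[m/n]*n; m%n<n; m/n*n≤m; m*n/n≡m; /-monoˡ-≤)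
open import Data.Nat.Divisibility using (_∣_; _∣?_; ∣m+n∣m⇒∣n; ∣m∣n⇒∣m+n; ∣-trans; m∣m*n; n∣m*n)
open import Data.Nat.Primality using (Prime; prime?; ¬prime[0])
import Data.Nat.Coprimality as Coprime
open import Data.Integer.Base as ℤ using (+_; +≤+)
import Data.Integer.Properties as ℤ
open import Data.Rational.Base as ℚ using (ℚ; mkℚ; 0ℚ; ∣_∣; *≤*; nonNegative)
  renaming (_≤_ to _≤ℚ_)
import Data.Rational.Properties as ℚ
open import Data.Rational.Solver using (module +-*-Solver)
open import Algebra.Properties.Group ℚ.+-0-group using (⁻¹-involutive)
open import Data.List.Base using (List; length; filter; applyDownFrom)
open import Data.List.Membership.Propositional using (_∈_)
open import Data.List.Membership.Propositional.Properties using (∈-filter⁺; ∈-filter⁻; ∈-applyDownFrom⁺; ∈-applyDownFrom⁻)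
open import Data.List.Membership.Propositional.Properties.WithK using (unique∧set⇒bag)
open import Data.List.Relation.Binary.BagAndSetEquality using (∼bag⇒↭)
open import Data.List.Relation.Binary.Permutation.Propositional.Properties using (↭-length)
open import Data.List.Relation.Unary.Unique.Propositional using (Unique)
import Data.List.Relation.Unary.Unique.Propositional.Properties as Unique
open import Data.Product.Base using (_×_; _,_; uncurry)
open import Data.Product.Function.NonDependent.Propositional using (_×-⇔_)
open import Data.Sum.Base using (inj₁; inj₂)
open import Function.Bundles using (_⇔_; mk⇔; Equivalence)
import Function.Properties.Equivalence as ⇔
open import Relation.Nullary using (Dec; yes; no; does; ¬?; contradiction)
open import Relation.Nullary.Decidable using (does-⇔; map′; _→-dec_; _×-dec_; toWitness)
open import Relation.Unary using (Pred; Decidable)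
open import Function.Base using (_∘_)
open import Relation.Binary.PropositionalEquality

module Counting {P : Pred ℕ 0ℓ} (P? : Decidable P) where

  open import Data.Nat.Base using (_+_; _*_)

  enumerate : ℕ → List ℕ
  enumerate n = filter P? (applyDownFrom suc n)

  count : ℕ → ℕ
  count n = length (enumerate n)

  count-suc : ∀ n → count (suc n) ≡ (if does (P? (suc n)) then suc (count n) else count n)
  count-suc n with does (P? (suc n))
  ... | true  = refl
  ... | false = refl

  ∈-enumerate : ∀ {m n} → m ∈ enumerate n ⇔ (P m × 1 ≤ m × m ≤ n)
  ∈-enumerate {m} {n} = mk⇔ to from
    where
    to : m ∈ enumerate n → P m × 1 ≤ m × m ≤ n
    to m∈ with m∈range , Pm ← ∈-filter⁻ P? {xs = applyDownFrom suc n} m∈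
          with _ , i<n , refl ← ∈-applyDownFrom⁻ suc m∈range = Pm , s≤s z≤n , i<n
    from : P m × 1 ≤ m × m ≤ n → m ∈ enumerate n
    from (Pm , s≤s z≤n , m≤n) = ∈-filter⁺ P? (∈-applyDownFrom⁺ suc m≤n) Pm

  enumerate-unique : ∀ n → Unique (enumerate n)
  enumerate-unique n = Unique.filter⁺ P? (Unique.applyDownFrom⁺₁ suc n (λ j<i _ → ℕ.>⇒≢ (s≤s j<i)))

  length≡count : ∀ {xs n} → Unique xs → (∀ {m} → m ∈ xs ⇔ (P m × 1 ≤ m × m ≤ n)) → length xs ≡ count n
  length≡count {n = n} xs-unique xs≈ =
    ↭-length (∼bag⇒↭ (unique∧set⇒bag xs-unique (enumerate-unique n) (⇔.trans xs≈ (⇔.sym ∈-enumerate))))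

  module _ {M : ℕ} (periodic : ∀ m → P (m + M) ⇔ P m) where

    count-+ : ∀ n → count (n + M) ≡ count n + count M
    count-+ zero = refl
    count-+ (suc n) = begin
      count (suc n + M)
        ≡⟨ count-suc (n + M) ⟩
      (if does (P? (suc n + M)) then suc (count (n + M)) else count (n + M))
        ≡⟨ cong₂ (λ b k → if b then suc k else k) (does-⇔ (periodic (suc n)) (P? (suc n + M)) (P? (suc n))) (count-+ n) ⟩
      (if does (P? (suc n)) then suc (count n + count M) else count n + count M)
        ≡⟨ if-float (_+ count M) (does (P? (suc n))) ⟨
      (if does (P? (suc n)) then suc (count n) else count n) + count M
        ≡⟨ cong (_+ count M) (count-suc n) ⟨
      count (suc n) + count M ∎
      where open ≡-Reasoning

    count-+-* : ∀ n q → count (n + q * M) ≡ count n + q * count M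
    count-+-* n zero = trans (cong count (ℕ.+-identityʳ n)) (sym (ℕ.+-identityʳ (count n)))
    count-+-* n (suc q) = begin
      count (n + suc q * M)              ≡⟨ cong count (+-suc-* n q M) ⟩
      count (n + q * M + M)              ≡⟨ count-+ (n + q * M) ⟩
      count (n + q * M) + count M        ≡⟨ cong (_+ count M) (count-+-* n q) ⟩
      count n + q * count M + count M    ≡⟨ +-suc-* (count n) q (count M) ⟨
      count n + suc q * count M          ∎
      where
      open ≡-Reasoning
      +-suc-* : ∀ a b c → a + suc b * c ≡ a + b * c + c
      +-suc-* a b c = trans (cong (λ d → a + d) (ℕ.+-comm c (b * c))) (sym (ℕ.+-assoc a (b * c) c))

module Sieve where

  open import Data.Nat.Base using (_+_; _*_)

  A? : ∀ p → Decidable (A p)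
  A? p n = map′ (λ h q q-prime q≤p → h (s≤s q≤p) q-prime)
                (λ a {q} q<1+p q-prime → a q q-prime (ℕ.≤-pred q<1+p))
                (ℕ.allUpTo? (λ q → prime? q →-dec ¬? (q ∣? n)) (suc p))

  A-periodic : ∀ {p M} → (∀ {q} → Prime q → q ≤ p → q ∣ M) → ∀ m → A p (m + M) ⇔ A p m
  A-periodic {M = M} q∣M m = mk⇔
    (λ a q q-prime q≤p q∣m → a q q-prime q≤p (∣m∣n⇒∣m+n q∣m (q∣M q-prime q≤p)))
    (λ a q q-prime q≤p q∣m+M → a q q-prime q≤p
        (∣m+n∣m⇒∣n (subst (q ∣_) (ℕ.+-comm m M) q∣m+M) (q∣M q-prime q≤p)))

  primorial : ℕ → ℕ
  primorial zero = 1
  primorial (suc m) with prime? (suc m)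
  ... | yes _ = suc m * primorial m
  ... | no  _ = primorial m

  prime≤⇒∣primorial : ∀ {p q} → Prime q → q ≤ p → q ∣ primorial p
  prime≤⇒∣primorial {zero} q-prime z≤n = contradiction q-prime ¬prime[0]
  prime≤⇒∣primorial {suc m} q-prime q≤1+m with prime? (suc m) | ℕ.m≤n⇒m<n∨m≡n q≤1+m
  ... | yes _     | inj₂ refl       = m∣m*n (primorial m)
  ... | yes _     | inj₁ (s≤s q≤m) = ∣-trans (prime≤⇒∣primorial q-prime q≤m) (n∣m*n (suc m))
  ... | no ¬prime | inj₂ refl       = contradiction q-prime ¬prime
  ... | no _      | inj₁ (s≤s q≤m) = prime≤⇒∣primorial q-prime q≤m

  primorial-nonZero : ∀ p → NonZero (primorial p)
  primorial-nonZero zero = _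
  primorial-nonZero (suc m) with prime? (suc m)
  ... | yes _ = ℕ.m*n≢0 (suc m) (primorial m) where instance _ = primorial-nonZero m
  ... | no  _ = primorial-nonZero m

module Rationals where

  open import Data.Rational.Base using (_+_; _*_; _-_; -_; _/_)

  m*n≤o⇔m≤o/n : ∀ m n o .{{_ : NonZero n}} → m ℕ.* n ≤ o ⇔ m ≤ o ℕ./ n
  m*n≤o⇔m≤o/n m n o = mk⇔
    (λ m*n≤o → subst (_≤ o ℕ./ n) (m*n/n≡m m n) (/-monoˡ-≤ n m*n≤o))
    (λ m≤o/n → ℕ.≤-trans (ℕ.*-monoˡ-≤ n m≤o/n) (m/n*n≤m o n))

  ι≡mkℚ : ∀ n → ι n ≡ mkℚ (+ n) 0 (Coprime.sym (Coprime.1-coprimeTo n))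
  ι≡mkℚ n = ℚ.normalize-coprime (Coprime.sym (Coprime.1-coprimeTo n))

  ι-+ : ∀ m n → ι (m ℕ.+ n) ≡ ι m + ι n
  ι-+ m n = begin
    + (m ℕ.+ n) / 1                     ≡⟨ cong (_/ 1) (ℤ.pos-+ m n) ⟩
    (+ m ℤ.+ + n) / 1                   ≡⟨ cong₂ (λ i j → (i ℤ.+ j) / 1) (ℤ.*-identityʳ (+ m)) (ℤ.*-identityʳ (+ n)) ⟨
    (+ m ℤ.* + 1 ℤ.+ + n ℤ.* + 1) / 1   ≡⟨ cong₂ _+_ (ι≡mkℚ m) (ι≡mkℚ n) ⟨
    ι m + ι n                           ∎
    where open ≡-Reasoning

  ι-* : ∀ m n → ι (m ℕ.* n) ≡ ι m * ι n
  ι-* m n = begin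
    + (m ℕ.* n) / 1     ≡⟨ cong (_/ 1) (ℤ.pos-* m n) ⟩
    (+ m ℤ.* + n) / 1   ≡⟨ cong₂ _*_ (ι≡mkℚ m) (ι≡mkℚ n) ⟨
    ι m * ι n           ∎
    where open ≡-Reasoning

  ⌊_⌋ℕ : ℚ → ℕ
  ⌊ mkℚ (+ a)      d _ ⌋ℕ = a ℕ./ suc d
  ⌊ mkℚ ℤ.-[1+ _ ] _ _ ⌋ℕ = 0

  ι≤⇔≤⌊⌋ℕ : ∀ {x} m → 0ℚ ≤ℚ x → ι m ≤ℚ x ⇔ m ≤ ⌊ x ⌋ℕ
  ι≤⇔≤⌊⌋ℕ {mkℚ (+ a) d _} m _ rewrite ι≡mkℚ m = ⇔.trans ι≤⇔*≤ (m*n≤o⇔m≤o/n m (suc d) a)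
    where
    ι≤⇔*≤ : mkℚ (+ m) 0 _ ≤ℚ mkℚ (+ a) d _ ⇔ m ℕ.* suc d ≤ a
    ι≤⇔*≤ = mk⇔
      (λ m≤x → ℤ.drop‿+≤+ (subst₂ ℤ._≤_ (sym (ℤ.pos-* m (suc d))) (ℤ.*-identityʳ (+ a)) (ℚ.drop-*≤* m≤x)))
      (λ m*d≤a → *≤* (subst₂ ℤ._≤_ (ℤ.pos-* m (suc d)) (sym (ℤ.*-identityʳ (+ a))) (+≤+ m*d≤a)))
  ι≤⇔≤⌊⌋ℕ {mkℚ ℤ.-[1+ _ ] _ _} _ (*≤* ())

  ⌊⌋ℕ-bracket : ∀ {x} → 0ℚ ≤ℚ x → ι ⌊ x ⌋ℕ ≤ℚ x × x ≤ℚ ι (suc ⌊ x ⌋ℕ)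
  ⌊⌋ℕ-bracket {x} 0≤x =
    Equivalence.from (ι≤⇔≤⌊⌋ℕ _ 0≤x) ℕ.≤-refl ,
    ℚ.<⇒≤ (ℚ.≰⇒> (ℕ.1+n≰n ∘ Equivalence.to (ι≤⇔≤⌊⌋ℕ _ 0≤x)))

  -q≤p≤q⇒∣p∣≤q : ∀ {p q} → - q ≤ℚ p → p ≤ℚ q → ∣ p ∣ ≤ℚ q
  -q≤p≤q⇒∣p∣≤q {p} {q} -q≤p p≤q with ℚ.∣p∣≡p∨∣p∣≡-p p
  ... | inj₁ ∣p∣≡p  = subst (_≤ℚ q) (sym ∣p∣≡p) p≤q
  ... | inj₂ ∣p∣≡-p = subst₂ _≤ℚ_ (sym ∣p∣≡-p) (⁻¹-involutive q) (ℚ.neg-antimono-≤ -q≤p)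

  y-x*c-antitone : ∀ {c x x′} y → 0ℚ ≤ℚ c → x ≤ℚ x′ → y - x′ * c ≤ℚ y - x * c
  y-x*c-antitone {c} y 0≤c x≤x′ =
    ℚ.+-monoʳ-≤ y (ℚ.neg-antimono-≤ (ℚ.*-monoʳ-≤-nonNeg c x≤x′))
    where instance _ = nonNegative 0≤c

  ∣y-x*c∣≤-between : ∀ {c lo x hi B} y → 0ℚ ≤ℚ c → lo ≤ℚ x → x ≤ℚ hi →
                     y - lo * c ≤ℚ B → - B ≤ℚ y - hi * c → ∣ y - x * c ∣ ≤ℚ B
  ∣y-x*c∣≤-between y 0≤c lo≤x x≤hi at-lo at-hi = -q≤p≤q⇒∣p∣≤q
    (ℚ.≤-trans at-hi (y-x*c-antitone y 0≤c x≤hi))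
    (ℚ.≤-trans (y-x*c-antitone y 0≤c lo≤x) at-lo)

module Discrepancy where

  open import Data.Rational.Base using (_+_; _*_; _-_; -_)
  open Rationals

  discrepancy : ℚ → ℕ → ℕ → ℚ
  discrepancy c k n = ι k - ι n * c

  discrepancy-shift : ∀ {c K M} → ι K ≡ ι M * c →
                      ∀ k n q → discrepancy c (k ℕ.+ q ℕ.* K) (n ℕ.+ q ℕ.* M) ≡ discrepancy c k n
  discrepancy-shift {c} {K} {M} slope k n q = begin
    ι (k ℕ.+ q ℕ.* K) - ι (n ℕ.+ q ℕ.* M) * c
      ≡⟨ cong₂ (λ u v → u - v * c) (ι-+-* k q K) (ι-+-* n q M) ⟩
    (ι k + ι q * ι K) - (ι n + ι q * ι M) * c
      ≡⟨ cong (λ u → (ι k + ι q * u) - (ι n + ι q * ι M) * c) slope ⟩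
    (ι k + ι q * (ι M * c)) - (ι n + ι q * ι M) * c
      ≡⟨ cancel (ι k) (ι q) (ι M) c (ι n) ⟩
    ι k - ι n * c ∎
    where
    open ≡-Reasoning
    open +-*-Solver
    ι-+-* : ∀ a b d → ι (a ℕ.+ b ℕ.* d) ≡ ι a + ι b * ι d
    ι-+-* a b d = trans (ι-+ a (b ℕ.* d)) (cong (λ u → ι a + u) (ι-* b d))
    cancel : ∀ k q m c n → (k + q * (m * c)) - (n + q * m) * c ≡ k - n * c
    cancel = solve 5 (λ k q m c n → (k :+ q :* (m :* c)) :- (n :+ q :* m) :* c := k :- n :* c) refl

  Bounded : ℚ → ℚ → ℕ → ℕ → Set
  Bounded c B k n = discrepancy c k n ≤ℚ B × - B ≤ℚ discrepancy c k (suc n)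

  bounded? : ∀ c B k n → Dec (Bounded c B k n)
  bounded? c B k n = (discrepancy c k n ℚ.≤? B) ×-dec (- B ℚ.≤? discrepancy c k (suc n))

  module _ {N : ℕ → ℕ} {M : ℕ} .{{_ : NonZero M}} {c B : ℚ}
           (N-+-* : ∀ n q → N (n ℕ.+ q ℕ.* M) ≡ N n ℕ.+ q ℕ.* N M) (slope : ι (N M) ≡ ι M * c) where

    bounded-periodic : (∀ {r} → r < M → Bounded c B (N r) r) → ∀ n → Bounded c B (N n) n
    bounded-periodic bounded-on-period n =
      subst (λ n → Bounded c B (N n) n) (sym (m≡m%n+[m/n]*n n M))
            (shift {q = n ℕ./ M} (bounded-on-period (m%n<n n M)))
      where
      shift : ∀ {r q} → Bounded c B (N r) r → Bounded c B (N (r ℕ.+ q ℕ.* M)) (r ℕ.+ q ℕ.* M)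
      shift {r} {q} (at-r , at-1+r) rewrite N-+-* r q =
        subst (_≤ℚ B) (sym (discrepancy-shift slope (N r) r q)) at-r ,
        subst (- B ≤ℚ_) (sym (discrepancy-shift slope (N r) (suc r) q)) at-1+r

open Counting using (count; count-+-*; length≡count)
open Sieve using (A?; A-periodic; primorial; prime≤⇒∣primorial; primorial-nonZero)
open Rationals using (⌊_⌋ℕ; ι≤⇔≤⌊⌋ℕ; ⌊⌋ℕ-bracket; ∣y-x*c∣≤-between)
open Discrepancy using (Bounded; bounded?; bounded-periodic)
open import Data.Rational.Base using (_*_; _-_; _/_)

bound : ℚ
bound = + 53 / 35

Certified : ℕ → Set
Certified p = 0ℚ ≤ℚ eulerProd p
            × ι (count (A? p) (primorial p)) ≡ ι (primorial p) * eulerProd p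
            × (∀ {r} → r < primorial p → Bounded (eulerProd p) bound (count (A? p) r) r)

certified? : Decidable Certified
certified? p = (0ℚ ℚ.≤? eulerProd p)
         ×-dec (ι (count (A? p) (primorial p)) ℚ.≟ ι (primorial p) * eulerProd p)
         ×-dec ℕ.allUpTo? (λ r → bounded? (eulerProd p) bound (count (A? p) r) r) (primorial p)

-- Composite p ≤ 7 pass the check as well.
certified : ∀ {p} → p ≤ 7 → Certified p
certified p≤7 = toWitness {a? = ℕ.allUpTo? certified? 8} _ (s≤s p≤7)

lemma6p3 : (p : ℕ) → Prime p → p ≤ 7 → (x : ℚ) → 0ℚ ≤ℚ x → (k : ℕ) → CountIs p x k → ∣ ι k - x * eulerProd p ∣ ≤ℚ (+ 53 / 35)
lemma6p3 p _ p≤7 x 0≤x k (xs , xs-unique , xs≈ , length≡k) =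
  let c≥0 , slope , on-period = certified p≤7
      ⌊x⌋≤x , x≤1+⌊x⌋ = ⌊⌋ℕ-bracket 0≤x
      count-period = count-+-* (A? p) (A-periodic prime≤⇒∣primorial)
  in subst (λ k → ∣ ι k - x * eulerProd p ∣ ≤ℚ bound) count≡k
       (uncurry (∣y-x*c∣≤-between (ι (count (A? p) ⌊ x ⌋ℕ)) c≥0 ⌊x⌋≤x x≤1+⌊x⌋)
         (bounded-periodic count-period slope on-period ⌊ x ⌋ℕ))
  where
  instance _ = primorial-nonZero p
  count≡k : count (A? p) ⌊ x ⌋ℕ ≡ k
  count≡k = trans (sym (length≡count (A? p) xs-unique
    (λ {m} → ⇔.trans (xs≈ m) (⇔.refl ×-⇔ ⇔.refl ×-⇔ ι≤⇔≤⌊⌋ℕ m 0≤x)))) length≡k
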